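{- Let $\mathbf{C}$ be an extensive category with finite products. If for every object $X$ a free uniform-iteration algebra $KX$ on $X$ exists, then $K$ extends to a monad $\mathbb{K}$ on $\mathbf{C}$ whose (Eilenberg–Moore) algebras are precisely the uniform-iteration algebras (i.e. the category of $\mathbb{K}$-algebras is isomorphic to the category of uniform-iteration algebras over $\mathbf{C}$).
   Context: A uniform-iteration algebra is an object $A$ with an operator assigning to every $f\colon X\to A+X$ a morphism $f^\dagger\colon X\to A$ such that (Fixpoint) $f^\dagger=[\mathrm{id},f^\dagger]f$ and (Uniformity) for $f\colon X\to A+X$, $g\colon Y\to A+Y$, $h\colon X\to Y$, $(\mathrm{id}+h)f=gh$ implies $f^\dagger=g^\dagger h$. Morphisms $h\colon A\to B$ are those with $hf^\dagger=((h+\mathrm{id})f)^\dagger$ for all $f\colon X\to A+X$. A free uniform-iteration algebra on $X$ is one equipped with $\eta\colon X\to KX$ such that every morphism $X\to A$ into a uniform-iteration algebra factors uniquely as an algebra morphism $KX\to A$ precomposed with $\eta$. -}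

module Defs where

open import Level using (Level; _⊔_) renaming (suc to lsuc)
open import Relation.Binary using (Rel; IsEquivalence)
open import Data.Product using (Σ; Σ-syntax; _×_; _,_)

record Category (o ℓ e : Level) : Set (lsuc (o ⊔ ℓ ⊔ e)) where
  infixr 9 _∘_
  infix  4 _≈_
  infix  4 _⇒_
  field
    Obj       : Set o
    _⇒_       : Obj → Obj → Set ℓ
    _≈_       : ∀ {A B} → Rel (A ⇒ B) e
    id        : ∀ {A} → A ⇒ A
    _∘_       : ∀ {A B C} → B ⇒ C → A ⇒ B → A ⇒ C
    ≈-equiv   : ∀ {A B} → IsEquivalence (_≈_ {A} {B})
    ∘-resp-≈  : ∀ {A B C} {f g : B ⇒ C} {h i : A ⇒ B} → f ≈ g → h ≈ i → f ∘ h ≈ g ∘ i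
    assoc     : ∀ {A B C D} {f : A ⇒ B} {g : B ⇒ C} {h : C ⇒ D} → (h ∘ g) ∘ f ≈ h ∘ (g ∘ f)
    identityˡ : ∀ {A B} {f : A ⇒ B} → id ∘ f ≈ f
    identityʳ : ∀ {A B} {f : A ⇒ B} → f ∘ id ≈ f

module _ {o ℓ e : Level} (C : Category o ℓ e) where
  open Category C

  record BinaryCoproducts : Set (o ⊔ ℓ ⊔ e) where
    infixr 6 _+_
    field
      _+_     : Obj → Obj → Obj
      i₁      : ∀ {A B} → A ⇒ A + B
      i₂      : ∀ {A B} → B ⇒ A + B
      [_,_]   : ∀ {A B X} → A ⇒ X → B ⇒ X → A + B ⇒ X
      inject₁ : ∀ {A B X} {f : A ⇒ X} {g : B ⇒ X} → [ f , g ] ∘ i₁ ≈ f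
      inject₂ : ∀ {A B X} {f : A ⇒ X} {g : B ⇒ X} → [ f , g ] ∘ i₂ ≈ g
      unique  : ∀ {A B X} {f : A ⇒ X} {g : B ⇒ X} {h : A + B ⇒ X} →
                h ∘ i₁ ≈ f → h ∘ i₂ ≈ g → [ f , g ] ≈ h

  record Initial : Set (o ⊔ ℓ ⊔ e) where
    field
      ⊥        : Obj
      !        : ∀ {A} → ⊥ ⇒ A
      !-unique : ∀ {A} (f : ⊥ ⇒ A) → ! ≈ f

  record BinaryProducts : Set (o ⊔ ℓ ⊔ e) where
    infixr 7 _×ᵒ_
    field
      _×ᵒ_     : Obj → Obj → Obj
      π₁       : ∀ {A B} → A ×ᵒ B ⇒ A
      π₂       : ∀ {A B} → A ×ᵒ B ⇒ B
      ⟨_,_⟩    : ∀ {A B X} → X ⇒ A → X ⇒ B → X ⇒ A ×ᵒ B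
      project₁ : ∀ {A B X} {f : X ⇒ A} {g : X ⇒ B} → π₁ ∘ ⟨ f , g ⟩ ≈ f
      project₂ : ∀ {A B X} {f : X ⇒ A} {g : X ⇒ B} → π₂ ∘ ⟨ f , g ⟩ ≈ g
      unique   : ∀ {A B X} {f : X ⇒ A} {g : X ⇒ B} {h : X ⇒ A ×ᵒ B} →
                 π₁ ∘ h ≈ f → π₂ ∘ h ≈ g → ⟨ f , g ⟩ ≈ h

  record Terminal : Set (o ⊔ ℓ ⊔ e) where
    field
      ⊤        : Obj
      !ᵗ       : ∀ {A} → A ⇒ ⊤
      !ᵗ-unique : ∀ {A} (f : A ⇒ ⊤) → !ᵗ ≈ f

  record FiniteProducts : Set (o ⊔ ℓ ⊔ e) where
    field
      terminal : Terminal
      products : BinaryProducts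

  IsPullback : ∀ {P X Y Z} → X ⇒ Z → Y ⇒ Z → P ⇒ X → P ⇒ Y → Set (o ⊔ ℓ ⊔ e)
  IsPullback {P} {X} {Y} f g p₁ p₂ =
    (f ∘ p₁ ≈ g ∘ p₂) ×
    (∀ {Q} (h₁ : Q ⇒ X) (h₂ : Q ⇒ Y) → f ∘ h₁ ≈ g ∘ h₂ →
       Σ[ u ∈ Q ⇒ P ] (p₁ ∘ u ≈ h₁ × p₂ ∘ u ≈ h₂ ×
         (∀ (v : Q ⇒ P) → p₁ ∘ v ≈ h₁ → p₂ ∘ v ≈ h₂ → v ≈ u)))

  IsCoproduct : ∀ {X Y Z} → X ⇒ Z → Y ⇒ Z → Set (o ⊔ ℓ ⊔ e)
  IsCoproduct {X} {Y} {Z} x y =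
    ∀ {W} (f : X ⇒ W) (g : Y ⇒ W) →
      Σ[ u ∈ Z ⇒ W ] (u ∘ x ≈ f × u ∘ y ≈ g ×
        (∀ (v : Z ⇒ W) → v ∘ x ≈ f → v ∘ y ≈ g → v ≈ u))

  -- Extensive categories (Carboni–Lack–Walters, Prop. 2.2 form):
  -- finite coproducts, pullbacks along coproduct injections exist, and for
  -- every commutative diagram
  --      X --x--> Z <--y-- Y
  --      |a       |h       |b
  --      A --i₁-> A+B <-i₂- B
  -- the top row is a coproduct iff both squares are pullbacks.

  record Extensive : Set (o ⊔ ℓ ⊔ e) where
    field
      coproducts : BinaryCoproducts
      initial    : Initial
    open BinaryCoproducts coproducts
    field
      pullback₁ : ∀ {A B Z} (h : Z ⇒ A + B) →
                  Σ[ P ∈ Obj ] Σ[ p ∈ P ⇒ Z ] Σ[ q ∈ P ⇒ A ] IsPullback h i₁ p q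
      pullback₂ : ∀ {A B Z} (h : Z ⇒ A + B) →
                  Σ[ P ∈ Obj ] Σ[ p ∈ P ⇒ Z ] Σ[ q ∈ P ⇒ B ] IsPullback h i₂ p q
      extensive : ∀ {A B X Y Z} (x : X ⇒ Z) (y : Y ⇒ Z) (h : Z ⇒ A + B)
                    (a : X ⇒ A) (b : Y ⇒ B) →
                  h ∘ x ≈ i₁ ∘ a → h ∘ y ≈ i₂ ∘ b →
                  (IsCoproduct x y → IsPullback h i₁ x a × IsPullback h i₂ y b) ×
                  (IsPullback h i₁ x a × IsPullback h i₂ y b → IsCoproduct x y)

  module _ (cp : BinaryCoproducts) where
    open BinaryCoproducts cp

    infixr 6 _+₁_
    _+₁_ : ∀ {A B A' B'} → A ⇒ A' → B ⇒ B' → A + B ⇒ A' + B'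
    f +₁ g = [ i₁ ∘ f , i₂ ∘ g ]

    record UIAStructure (A : Obj) : Set (o ⊔ ℓ ⊔ e) where
      field
        _† : ∀ {X} → X ⇒ A + X → X ⇒ A
        fixpoint   : ∀ {X} {f : X ⇒ A + X} → f † ≈ [ id , f † ] ∘ f
        uniformity : ∀ {X Y} {f : X ⇒ A + X} {g : Y ⇒ A + Y} {h : X ⇒ Y} →
                     (id +₁ h) ∘ f ≈ g ∘ h → f † ≈ (g †) ∘ h

    IsUIAMorphism : ∀ {A B} → UIAStructure A → UIAStructure B → A ⇒ B → Set (o ⊔ ℓ ⊔ e)
    IsUIAMorphism {A} α β h =
      ∀ {X} (f : X ⇒ A + X) → h ∘ UIAStructure._† α f ≈ UIAStructure._† β ((h +₁ id) ∘ f)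

    record FreeUIA (X : Obj) : Set (o ⊔ ℓ ⊔ e) where
      field
        KX  : Obj
        alg : UIAStructure KX
        η   : X ⇒ KX
        universal : ∀ {A} (α : UIAStructure A) (f : X ⇒ A) →
                    Σ[ g ∈ KX ⇒ A ] (IsUIAMorphism alg α g × g ∘ η ≈ f ×
                      (∀ (g' : KX ⇒ A) → IsUIAMorphism alg α g' → g' ∘ η ≈ f → g' ≈ g))

  record MonadOn (T : Obj → Obj) : Set (o ⊔ ℓ ⊔ e) where
    field
      map          : ∀ {A B} → A ⇒ B → T A ⇒ T B
      map-resp-≈   : ∀ {A B} {f g : A ⇒ B} → f ≈ g → map f ≈ map g
      map-id       : ∀ {A} → map (id {A}) ≈ id
      map-∘        : ∀ {A B D} {f : A ⇒ B} {g : B ⇒ D} → map (g ∘ f) ≈ map g ∘ map f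
      unit         : ∀ {A} → A ⇒ T A
      mult         : ∀ {A} → T (T A) ⇒ T A
      unit-natural : ∀ {A B} {f : A ⇒ B} → unit ∘ f ≈ map f ∘ unit
      mult-natural : ∀ {A B} {f : A ⇒ B} → mult ∘ map (map f) ≈ map f ∘ mult
      mult-assoc   : ∀ {A} → mult {A} ∘ map mult ≈ mult ∘ mult
      mult-unitˡ   : ∀ {A} → mult {A} ∘ map unit ≈ id
      mult-unitʳ   : ∀ {A} → mult {A} ∘ unit ≈ id

  module _ {T : Obj → Obj} (M : MonadOn T) where
    open MonadOn M

    record EMStructure (A : Obj) : Set (o ⊔ ℓ ⊔ e) where
      field
        act      : T A ⇒ A
        act-unit : act ∘ unit ≈ id
        act-mult : act ∘ map act ≈ act ∘ mult

    IsEMMorphism : ∀ {A B} → EMStructure A → EMStructure B → A ⇒ B → Set e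
    IsEMMorphism α β h = h ∘ EMStructure.act α ≈ EMStructure.act β ∘ map h

    -- An isomorphism over C between the category of Eilenberg–Moore
    -- M-algebras and the category of uniform-iteration algebras:
    -- a bijection (up to equality of structures) between the algebra
    -- structures on each object A, under which the morphisms (arrows of C
    -- satisfying the respective homomorphism conditions) coincide.
    record EMIsoUIA (cp : BinaryCoproducts) : Set (o ⊔ ℓ ⊔ e) where
      field
        toUIA : ∀ {A} → EMStructure A → UIAStructure cp A
        toEM  : ∀ {A} → UIAStructure cp A → EMStructure A
        toEM∘toUIA : ∀ {A} (α : EMStructure A) →
                     EMStructure.act (toEM (toUIA α)) ≈ EMStructure.act α
        toUIA∘toEM : ∀ {A} (α : UIAStructure cp A) {X} (f : X ⇒ BinaryCoproducts._+_ cp A X) →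
                     UIAStructure._† (toUIA (toEM α)) f ≈ UIAStructure._† α f
        morphisms  : ∀ {A B} (α : EMStructure A) (β : EMStructure B) (h : A ⇒ B) →
                     (IsEMMorphism α β h → IsUIAMorphism cp (toUIA α) (toUIA β) h) ×
                     (IsUIAMorphism cp (toUIA α) (toUIA β) h → IsEMMorphism α β h)

module Submission where

-- K is the monad of the adjunction between C and the category of uniform-iteration
-- algebras: μ and the functorial action are extensions along η, and every monad law
-- holds because algebra morphisms out of a free algebra are determined by their
-- restriction along η. An Eilenberg–Moore algebra a : K A → A iterates f as
-- a ∘ ((η +₁ id) ∘ f)†, and an iteration algebra acts by the extension of id.
-- These are mutually inverse since a is itself an iteration-algebra morphism
-- out of K A, hence the extension of a ∘ η = id.

open import Defs hiding (_+₁_)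
open import Data.Product using (Σ; _×_; _,_; proj₁; proj₂)
open import Level using (Level)
open import Relation.Binary using (Setoid; IsEquivalence)
import Relation.Binary.Reasoning.Setoid as SetoidReasoning

module HomReasoning {o ℓ e : Level} (C : Category o ℓ e) where
  open Category C

  hom : Obj → Obj → Setoid ℓ e
  hom A B = record { Carrier = A ⇒ B ; _≈_ = _≈_ ; isEquivalence = ≈-equiv }

  module _ {A B : Obj} where
    open IsEquivalence (≈-equiv {A} {B}) public using (refl; sym; trans)

  module Reasoning {A B : Obj} = SetoidReasoning (hom A B)
  open Reasoning public

  ∘-congˡ : ∀ {A B D} {h : B ⇒ D} {f g : A ⇒ B} → f ≈ g → h ∘ f ≈ h ∘ g
  ∘-congˡ = ∘-resp-≈ refl

  ∘-congʳ : ∀ {A B D} {h : A ⇒ B} {f g : B ⇒ D} → f ≈ g → f ∘ h ≈ g ∘ h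
  ∘-congʳ p = ∘-resp-≈ p refl

  pullˡ : ∀ {A B D E} {a : D ⇒ E} {b : B ⇒ D} {c : B ⇒ E} {f : A ⇒ B} →
          a ∘ b ≈ c → a ∘ (b ∘ f) ≈ c ∘ f
  pullˡ p = trans (sym assoc) (∘-congʳ p)

  pullʳ : ∀ {A B D E} {f : D ⇒ E} {a : B ⇒ D} {b : A ⇒ B} {c : A ⇒ D} →
          a ∘ b ≈ c → (f ∘ a) ∘ b ≈ f ∘ c
  pullʳ p = trans assoc (∘-congˡ p)

  extendˡ : ∀ {A B B' D E} {a : B ⇒ E} {b : D ⇒ B} {c : B' ⇒ E} {d : D ⇒ B'} {f : A ⇒ D} →
            a ∘ b ≈ c ∘ d → a ∘ (b ∘ f) ≈ c ∘ (d ∘ f)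
  extendˡ p = trans (pullˡ p) assoc

  cancelˡ : ∀ {A B D} {r : B ⇒ A} {s : A ⇒ B} {f : D ⇒ A} → r ∘ s ≈ id → r ∘ (s ∘ f) ≈ f
  cancelˡ p = trans (pullˡ p) identityˡ

module CoproductLaws {o ℓ e : Level} (C : Category o ℓ e) (cp : BinaryCoproducts C) where
  open Category C
  open BinaryCoproducts cp
  open HomReasoning C

  infixr 6 _+₁_
  _+₁_ : ∀ {A B A' B'} → A ⇒ A' → B ⇒ B' → A + B ⇒ A' + B'
  _+₁_ = Defs._+₁_ C cp

  []-cong₂ : ∀ {A B X} {f f' : A ⇒ X} {g g' : B ⇒ X} → f ≈ f' → g ≈ g' → [ f , g ] ≈ [ f' , g' ]
  []-cong₂ p q = sym (unique (trans inject₁ p) (trans inject₂ q))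

  ∘[] : ∀ {A B X Y} {f : A ⇒ X} {g : B ⇒ X} {h : X ⇒ Y} → h ∘ [ f , g ] ≈ [ h ∘ f , h ∘ g ]
  ∘[] = sym (unique (pullʳ inject₁) (pullʳ inject₂))

  []∘+₁ : ∀ {A B A' B' X} {f : A' ⇒ X} {g : B' ⇒ X} {a : A ⇒ A'} {b : B ⇒ B'} →
          [ f , g ] ∘ (a +₁ b) ≈ [ f ∘ a , g ∘ b ]
  []∘+₁ = trans ∘[] ([]-cong₂ (pullˡ inject₁) (pullˡ inject₂))

  +₁∘+₁ : ∀ {A B A' B' A'' B''} {a : A' ⇒ A''} {b : B' ⇒ B''} {c : A ⇒ A'} {d : B ⇒ B'} →
          (a +₁ b) ∘ (c +₁ d) ≈ (a ∘ c) +₁ (b ∘ d)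
  +₁∘+₁ = trans []∘+₁ ([]-cong₂ assoc assoc)

  +₁-cong₂ : ∀ {A B A' B'} {a a' : A ⇒ A'} {b b' : B ⇒ B'} → a ≈ a' → b ≈ b' → a +₁ b ≈ a' +₁ b'
  +₁-cong₂ p q = []-cong₂ (∘-congˡ p) (∘-congˡ q)

  +₁-identity : ∀ {A B} → id {A} +₁ id {B} ≈ id
  +₁-identity = unique (trans identityˡ (sym identityʳ)) (trans identityˡ (sym identityʳ))

  +₁-square : ∀ {A B A' B' A'' B'' P Q} {a : P ⇒ A''} {b : Q ⇒ B''} {c : A ⇒ P} {d : B ⇒ Q}
                {a' : A' ⇒ A''} {b' : B' ⇒ B''} {c' : A ⇒ A'} {d' : B ⇒ B'} →
              a ∘ c ≈ a' ∘ c' → b ∘ d ≈ b' ∘ d' → (a +₁ b) ∘ (c +₁ d) ≈ (a' +₁ b') ∘ (c' +₁ d')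
  +₁-square p q = trans +₁∘+₁ (trans (+₁-cong₂ p q) (sym +₁∘+₁))

  +₁-retract : ∀ {A B X} {r : B ⇒ A} {s : A ⇒ B} → r ∘ s ≈ id → (r +₁ id {X}) ∘ (s +₁ id) ≈ id
  +₁-retract p = trans +₁∘+₁ (trans (+₁-cong₂ p identityˡ) +₁-identity)

module UniformIteration {o ℓ e : Level} (C : Category o ℓ e) (cp : BinaryCoproducts C) where
  open Category C
  open BinaryCoproducts cp
  open HomReasoning C
  open CoproductLaws C cp

  UIA : Obj → Set _
  UIA = UIAStructure C cp

  IsMorphism : ∀ {A B} → UIA A → UIA B → A ⇒ B → Set _
  IsMorphism = IsUIAMorphism C cp

  open UIAStructure using (_†)

  †-cong : ∀ {A X} (α : UIA A) {f g : X ⇒ A + X} → f ≈ g → (α †) f ≈ (α †) g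
  †-cong α p = trans (UIAStructure.uniformity α uniformity-premise) identityʳ
    where uniformity-premise = trans (∘-congʳ +₁-identity) (trans identityˡ (trans p (sym identityʳ)))

  id-isMorphism : ∀ {A} (α : UIA A) → IsMorphism α α id
  id-isMorphism α f = trans identityˡ (†-cong α (sym (trans (∘-congʳ +₁-identity) identityˡ)))

  ∘-isMorphism : ∀ {A B D} (α : UIA A) (β : UIA B) (γ : UIA D) {g : A ⇒ B} {h : B ⇒ D} →
                 IsMorphism α β g → IsMorphism β γ h → IsMorphism α γ (h ∘ g)
  ∘-isMorphism α β γ {g} {h} g-mor h-mor f = begin
    (h ∘ g) ∘ (α †) f                        ≈⟨ pullʳ (g-mor f) ⟩
    h ∘ (β †) ((g +₁ id) ∘ f)                ≈⟨ h-mor _ ⟩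
    (γ †) ((h +₁ id) ∘ ((g +₁ id) ∘ f))      ≈⟨ †-cong γ (pullˡ (trans +₁∘+₁ (+₁-cong₂ refl identityˡ))) ⟩
    (γ †) (((h ∘ g) +₁ id) ∘ f)              ∎

module FreeAlgebraMonad {o ℓ e : Level} (C : Category o ℓ e) (cp : BinaryCoproducts C)
                        (free : ∀ X → FreeUIA C cp X) where
  open Category C
  open HomReasoning C
  open UniformIteration C cp

  K : Obj → Obj
  K X = FreeUIA.KX (free X)

  𝒦 : ∀ X → UIA (K X)
  𝒦 X = FreeUIA.alg (free X)

  η : ∀ {X} → X ⇒ K X
  η {X} = FreeUIA.η (free X)

  extend : ∀ {X A} (α : UIA A) → X ⇒ A → K X ⇒ A
  extend {X} α f = proj₁ (FreeUIA.universal (free X) α f)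

  extend-isMorphism : ∀ {X A} (α : UIA A) (f : X ⇒ A) → IsMorphism (𝒦 X) α (extend α f)
  extend-isMorphism {X} α f = proj₁ (proj₂ (FreeUIA.universal (free X) α f))

  extend-η : ∀ {X A} (α : UIA A) {f : X ⇒ A} → extend α f ∘ η ≈ f
  extend-η {X} α {f} = proj₁ (proj₂ (proj₂ (FreeUIA.universal (free X) α f)))

  extend-unique : ∀ {X A} (α : UIA A) {f : X ⇒ A} {g : K X ⇒ A} →
                  IsMorphism (𝒦 X) α g → g ∘ η ≈ f → g ≈ extend α f
  extend-unique {X} α {f} {g} = proj₂ (proj₂ (proj₂ (FreeUIA.universal (free X) α f))) g

  η-cancel : ∀ {X A} (α : UIA A) {g g' : K X ⇒ A} →
             IsMorphism (𝒦 X) α g → IsMorphism (𝒦 X) α g' → g ∘ η ≈ g' ∘ η → g ≈ g'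
  η-cancel α g-mor g'-mor p = trans (extend-unique α g-mor p) (sym (extend-unique α g'-mor refl))

  map : ∀ {A B} → A ⇒ B → K A ⇒ K B
  map {B = B} f = extend (𝒦 B) (η ∘ f)

  map-isMorphism : ∀ {A B} (f : A ⇒ B) → IsMorphism (𝒦 A) (𝒦 B) (map f)
  map-isMorphism {B = B} f = extend-isMorphism (𝒦 B) (η ∘ f)

  map-η : ∀ {A B} {f : A ⇒ B} → map f ∘ η ≈ η ∘ f
  map-η {B = B} = extend-η (𝒦 B)

  μ : ∀ {A} → K (K A) ⇒ K A
  μ {A} = extend (𝒦 A) id

  μ-isMorphism : ∀ {A} → IsMorphism (𝒦 (K A)) (𝒦 A) μ
  μ-isMorphism {A} = extend-isMorphism (𝒦 A) id

  μ-η : ∀ {A} → μ {A} ∘ η ≈ id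
  μ-η {A} = extend-η (𝒦 A)

  ∘μ-η : ∀ {A B} {a : K A ⇒ B} → (a ∘ μ) ∘ η ≈ a
  ∘μ-η = trans (pullʳ μ-η) identityʳ

  ∘map-η : ∀ {A B} {a : K A ⇒ A} {x : B ⇒ A} → a ∘ η ≈ id → (a ∘ map x) ∘ η ≈ x
  ∘map-η p = trans (pullʳ map-η) (trans (pullˡ p) identityˡ)

  monad : MonadOn C K
  monad = record
    { map          = map
    ; map-resp-≈   = λ {A} {B} {f} {g} p → η-cancel (𝒦 B) (map-isMorphism f) (map-isMorphism g)
                       (trans map-η (trans (∘-congˡ p) (sym map-η)))
    ; map-id       = λ {A} → η-cancel (𝒦 A) (map-isMorphism id) (id-isMorphism (𝒦 A))
                       (trans map-η (trans identityʳ (sym identityˡ)))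
    ; map-∘        = λ {A} {B} {D} {f} {g} → η-cancel (𝒦 D) (map-isMorphism (g ∘ f))
                       (∘-isMorphism (𝒦 A) (𝒦 B) (𝒦 D) (map-isMorphism f) (map-isMorphism g))
                       (trans map-η (sym (trans (pullʳ map-η) (trans (pullˡ map-η) assoc))))
    ; unit         = η
    ; mult         = μ
    ; unit-natural = sym map-η
    ; mult-natural = λ {A} {B} {f} → η-cancel (𝒦 B)
                       (∘-isMorphism (𝒦 (K A)) (𝒦 (K B)) (𝒦 B) (map-isMorphism (map f)) μ-isMorphism)
                       (∘-isMorphism (𝒦 (K A)) (𝒦 A) (𝒦 B) μ-isMorphism (map-isMorphism f))
                       (trans (∘map-η μ-η) (sym ∘μ-η))
    ; mult-assoc   = λ {A} → η-cancel (𝒦 A)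
                       (∘-isMorphism (𝒦 (K (K A))) (𝒦 (K A)) (𝒦 A) (map-isMorphism μ) μ-isMorphism)
                       (∘-isMorphism (𝒦 (K (K A))) (𝒦 (K A)) (𝒦 A) μ-isMorphism μ-isMorphism)
                       (trans (∘map-η μ-η) (sym ∘μ-η))
    ; mult-unitˡ   = λ {A} → η-cancel (𝒦 A)
                       (∘-isMorphism (𝒦 A) (𝒦 (K A)) (𝒦 A) (map-isMorphism η) μ-isMorphism)
                       (id-isMorphism (𝒦 A))
                       (trans (∘map-η μ-η) (sym identityˡ))
    ; mult-unitʳ   = μ-η
    }

module EilenbergMooreAlgebras {o ℓ e : Level} (C : Category o ℓ e) (cp : BinaryCoproducts C)
                              (free : ∀ X → FreeUIA C cp X) where
  open Category C
  open BinaryCoproducts cp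
  open HomReasoning C
  open CoproductLaws C cp
  open UniformIteration C cp
  open FreeAlgebraMonad C cp free
  open UIAStructure using (_†)
  open EMStructure

  EM : Obj → Set _
  EM = EMStructure C monad

  map-†-η : ∀ {A B X} {h : A ⇒ B} {f : X ⇒ A + X} →
            map h ∘ (𝒦 A †) ((η +₁ id) ∘ f) ≈ (𝒦 B †) ((η +₁ id) ∘ ((h +₁ id) ∘ f))
  map-†-η {h = h} {f} = trans (map-isMorphism h _)
    (†-cong (𝒦 _) (extendˡ (+₁-square map-η refl)))

  toUIA : ∀ {A} → EM A → UIA A
  toUIA {A} α = record
    { _†         = λ f → act α ∘ (𝒦 A †) ((η +₁ id) ∘ f)
    ; fixpoint   = λ {X} {f} → begin
        act α ∘ (𝒦 A †) ((η +₁ id) ∘ f)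
          ≈⟨ ∘-congˡ (UIAStructure.fixpoint (𝒦 A)) ⟩
        act α ∘ ([ id , (𝒦 A †) ((η +₁ id) ∘ f) ] ∘ ((η +₁ id) ∘ f))
          ≈⟨ ∘-congˡ (pullˡ []∘+₁) ⟩
        act α ∘ ([ id ∘ η , (𝒦 A †) ((η +₁ id) ∘ f) ∘ id ] ∘ f)
          ≈⟨ pullˡ ∘[] ⟩
        [ act α ∘ (id ∘ η) , act α ∘ ((𝒦 A †) ((η +₁ id) ∘ f) ∘ id) ] ∘ f
          ≈⟨ ∘-congʳ ([]-cong₂ (trans (∘-congˡ identityˡ) (act-unit α)) (∘-congˡ identityʳ)) ⟩
        [ id , act α ∘ (𝒦 A †) ((η +₁ id) ∘ f) ] ∘ f ∎
    ; uniformity = λ {X} {Y} {f} {g} {h} p → trans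
        (∘-congˡ (UIAStructure.uniformity (𝒦 A)
          (trans (extendˡ (+₁-square (trans identityˡ (sym identityʳ)) (trans identityʳ (sym identityˡ))))
                 (trans (∘-congˡ p) (sym assoc)))))
        (sym assoc)
    }

  toEM : ∀ {A} → UIA A → EM A
  toEM {A} β = record
    { act      = extend β id
    ; act-unit = extend-η β
    ; act-mult = η-cancel β
        (∘-isMorphism (𝒦 (K A)) (𝒦 A) β (map-isMorphism (extend β id)) (extend-isMorphism β id))
        (∘-isMorphism (𝒦 (K A)) (𝒦 A) β μ-isMorphism (extend-isMorphism β id))
        (trans (∘map-η (extend-η β)) (sym ∘μ-η))
    }

  -- Rewriting f as (μ +₁ id) ∘ (η +₁ id) ∘ f lets the associativity law of α move
  -- act α through the iteration.
  act-isMorphism : ∀ {A} (α : EM A) → IsMorphism (𝒦 A) (toUIA α) (act α)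
  act-isMorphism {A} α {X} f = begin
      act α ∘ (𝒦 A †) f                       ≈⟨ ∘-congˡ (sym μ-†) ⟩
      act α ∘ (μ ∘ (𝒦 (K A) †) g)             ≈⟨ pullˡ (sym (act-mult α)) ⟩
      (act α ∘ map (act α)) ∘ (𝒦 (K A) †) g   ≈⟨ pullʳ map-†-η ⟩
      act α ∘ (𝒦 A †) ((η +₁ id) ∘ ((act α +₁ id) ∘ f)) ∎
    where
      g = (η +₁ id) ∘ f
      μ-† : μ ∘ (𝒦 (K A) †) g ≈ (𝒦 A †) f
      μ-† = trans (μ-isMorphism g) (†-cong (𝒦 A) (cancelˡ (+₁-retract μ-η)))

  isEMMorphism⇒isMorphism : ∀ {A B} (α : EM A) (β : EM B) {h : A ⇒ B} →
                            IsEMMorphism C monad α β h → IsMorphism (toUIA α) (toUIA β) h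
  isEMMorphism⇒isMorphism {A} {B} α β {h} p f = begin
    h ∘ (act α ∘ (𝒦 A †) ((η +₁ id) ∘ f))          ≈⟨ pullˡ p ⟩
    (act β ∘ map h) ∘ (𝒦 A †) ((η +₁ id) ∘ f)      ≈⟨ pullʳ map-†-η ⟩
    act β ∘ (𝒦 B †) ((η +₁ id) ∘ ((h +₁ id) ∘ f)) ∎

  isMorphism⇒isEMMorphism : ∀ {A B} (α : EM A) (β : EM B) {h : A ⇒ B} →
                            IsMorphism (toUIA α) (toUIA β) h → IsEMMorphism C monad α β h
  isMorphism⇒isEMMorphism {A} {B} α β {h} p = η-cancel (toUIA β)
    (∘-isMorphism (𝒦 A) (toUIA α) (toUIA β) (act-isMorphism α) p)
    (∘-isMorphism (𝒦 A) (𝒦 B) (toUIA β) (map-isMorphism h) (act-isMorphism β))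
    (trans (pullʳ (act-unit α)) (trans identityʳ (sym (∘map-η (act-unit β)))))

  emIsoUIA : EMIsoUIA C monad cp
  emIsoUIA = record
    { toUIA      = toUIA
    ; toEM       = toEM
    ; toEM∘toUIA = λ α → sym (extend-unique (toUIA α) (act-isMorphism α) (act-unit α))
    ; toUIA∘toEM = λ β f → trans (extend-isMorphism β id _)
                     (†-cong β (cancelˡ (+₁-retract (extend-η β))))
    ; morphisms  = λ α β h → isEMMorphism⇒isMorphism α β , isMorphism⇒isEMMorphism α β
    }

lemma5p4 : ∀ {o ℓ e} (C : Category o ℓ e) (ext : Extensive C) (prod : FiniteProducts C)
    (free : ∀ X → FreeUIA C (Extensive.coproducts ext) X) →
    Σ (MonadOn C (λ X → FreeUIA.KX (free X))) λ M →
    (∀ {X} → Category._≈_ C (MonadOn.unit M {X}) (FreeUIA.η (free X))) ×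
    EMIsoUIA C M (Extensive.coproducts ext)
lemma5p4 C ext _ free = monad , refl , emIsoUIA
  where
    open HomReasoning C using (refl)
    open EilenbergMooreAlgebras C (Extensive.coproducts ext) free
    open FreeAlgebraMonad C (Extensive.coproducts ext) free using (monad)
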